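{- For any modal formula $A$, if $\mathbf{NR} \vdash A$, then $A$ is valid in all serial $\mathbf{N}$-frames.
   Context: Modal formulas are built from propositional variables and $\bot$ using $\neg,\land,\lor,\to$ and $\Box$. $\mathbf{N}$ has all propositional tautologies as axioms and Modus Ponens and Necessitation $A/\Box A$ as rules; $\mathbf{NR}$ is $\mathbf{N}$ plus the rule $\neg B/\neg\Box B$. An $\mathbf{N}$-frame is $(W, \{\prec_B\}_B)$ with $W$ nonempty and a binary relation $\prec_B$ on $W$ for each modal formula $B$; an $\mathbf{N}$-model adds $\Vdash$ with usual propositional clauses and $x\Vdash\Box B$ iff $y\Vdash B$ for all $y$ with $x\prec_B y$. A formula is valid in a frame if it holds at every world of every model based on the frame. The frame is serial if for every modal formula $B$ and every $x\in W$ there is $y$ with $x\prec_B y$. -}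

module Defs where

open import Data.Nat using (ℕ)
open import Data.Bool using (Bool; true; false; not; _∧_; _∨_)
open import Data.Empty using (⊥)
open import Data.Product using (_×_; Σ)
open import Data.Sum using (_⊎_)
open import Relation.Binary.PropositionalEquality using (_≡_)
open import Relation.Nullary using (¬_)

data Fm : Set where
  var  : ℕ → Fm
  bot  : Fm
  neg  : Fm → Fm
  _&_  : Fm → Fm → Fm
  _∣∣_ : Fm → Fm → Fm
  _⇒_  : Fm → Fm → Fm
  box  : Fm → Fm

_⇒ᵇ_ : Bool → Bool → Bool
a ⇒ᵇ b = not a ∨ b

evalB : (ℕ → Bool) → (Fm → Bool) → Fm → Bool
evalB pv bv (var n)   = pv n
evalB pv bv bot       = false
evalB pv bv (neg A)   = not (evalB pv bv A)
evalB pv bv (A & B)   = evalB pv bv A ∧ evalB pv bv B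
evalB pv bv (A ∣∣ B)  = evalB pv bv A ∨ evalB pv bv B
evalB pv bv (A ⇒ B)   = evalB pv bv A ⇒ᵇ evalB pv bv B
evalB pv bv (box B)   = bv B

-- A propositional tautology (substitution instance of a tautology):
-- true under every valuation of variables and of the maximal boxed subformulas.
Tautology : Fm → Set
Tautology A = ∀ (pv : ℕ → Bool) (bv : Fm → Bool) → evalB pv bv A ≡ true

data NR⊢_ : Fm → Set where
  taut : ∀ {A} → Tautology A → NR⊢ A
  mp   : ∀ {A B} → NR⊢ (A ⇒ B) → NR⊢ A → NR⊢ B
  nec  : ∀ {A} → NR⊢ A → NR⊢ box A
  rNR  : ∀ {B} → NR⊢ neg B → NR⊢ neg (box B)

record Frame : Set₁ where
  field
    W   : Set
    w₀  : W            -- nonemptiness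
    R   : Fm → W → W → Set

Valuation : Frame → Set₁
Valuation F = ℕ → Frame.W F → Set

-- The metatheory of the paper is classical; to make the
-- forcing clauses read classically in constructive Agda we use the
-- Goedel–Gentzen negative translation: atoms are double-negated, ∨ is
-- ¬(¬A × ¬B); all other clauses are the usual ones. Every forced
-- proposition is then ¬¬-stable, and classically each clause coincides
-- with the usual one.
_,_⊩_ : (F : Frame) → Valuation F → Frame.W F → Fm → Set
(F , V ⊩ x) (var n)  = ¬ ¬ V n x
(F , V ⊩ x) bot      = ⊥
(F , V ⊩ x) (neg A)  = ¬ (F , V ⊩ x) A
(F , V ⊩ x) (A & B)  = (F , V ⊩ x) A × (F , V ⊩ x) B
(F , V ⊩ x) (A ∣∣ B) = ¬ (¬ (F , V ⊩ x) A × ¬ (F , V ⊩ x) B)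
(F , V ⊩ x) (A ⇒ B)  = (F , V ⊩ x) A → (F , V ⊩ x) B
(F , V ⊩ x) (box B)  = ∀ y → Frame.R F B x y → (F , V ⊩ y) B

ValidIn : Frame → Fm → Set₁
ValidIn F A = ∀ (V : Valuation F) (x : Frame.W F) → (F , V ⊩ x) A

Serial : Frame → Set
Serial F = ∀ (B : Fm) (x : Frame.W F) → Σ (Frame.W F) (λ y → Frame.R F B x y)

-- Necessitation is sound in every
-- N-frame, and the rule ¬B / ¬□B only needs some ≺_B-successor of the
-- current world, which is exactly what seriality provides. For a tautology
-- A, forcing at a world is ¬¬-stable, so we may classically fix truth values
-- for the finitely many atoms of A (its variables and maximal boxed
-- subformulas); a Boolean valuation agreeing with forcing on those atoms
-- evaluates A to its forcing, and A evaluates to true under every valuation.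
module Submission where

open import Defs
open import Data.Bool using (Bool; false; _∨_; if_then_else_)
open import Data.List using (List; []; _∷_; [_]; _++_)
open import Data.List.Relation.Unary.All as All using (All; []; _∷_)
open import Data.List.Relation.Unary.All.Properties using (++⁻)
import Data.Nat.Properties as ℕ
open import Data.Product using (_×_; _,_; Σ-syntax; proj₁; proj₂; uncurry)
open import Effect.Monad using (RawMonad)
import Level
open import Function using (_∘_; id; const)
open import Relation.Binary.Definitions using (DecidableEquality)
open import Relation.Binary.PropositionalEquality using (_≢_; refl; cong; cong₂; subst)
open import Relation.Nullary using (¬_; Stable; yes; no; does; proof; map′; _×-dec_; ¬¬-excluded-middle; contradiction; negated-stable; ¬¬-map)
open import Relation.Nullary.Negation using (¬¬-Monad)
open import Relation.Nullary.Reflects using (Reflects; ofʸ; ofⁿ; invert; ¬-reflects; _×-reflects_; _→-reflects_)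

open RawMonad (¬¬-Monad {Level.zero}) using (pure; _>>=_)

module _ {A : Set} (_≟_ : DecidableEquality A) (P : A → Set) where

  _[_≔_] : (A → Bool) → A → Bool → A → Bool
  (g [ x ≔ v ]) y = if does (x ≟ y) then v else g y

  ≔-reflects : ∀ {g x v} → Reflects (P x) v →
               ∀ {y} → (x ≢ y → Reflects (P y) (g y)) → Reflects (P y) ((g [ x ≔ v ]) y)
  ≔-reflects {x = x} rx {y} ry with x ≟ y
  ... | yes refl = rx
  ... | no x≢y   = ry x≢y

  ¬¬-reflecting-assignment : ∀ xs → ¬ ¬ (Σ[ g ∈ (A → Bool) ] All (λ x → Reflects (P x) (g x)) xs)
  ¬¬-reflecting-assignment []       = pure (const false , [])
  ¬¬-reflecting-assignment (x ∷ xs) = do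
    g , rs ← ¬¬-reflecting-assignment xs
    x? ← ¬¬-excluded-middle
    let extend = ≔-reflects {g} (proof x?)
    pure (g [ x ≔ does x? ] , extend (λ x≢x → contradiction refl x≢x) ∷ All.map (extend ∘ const) rs)

¬¬-⊎-reflects : ∀ {P Q : Set} {a b} → Reflects P a → Reflects Q b → Reflects (¬ (¬ P × ¬ Q)) (a ∨ b)
¬¬-⊎-reflects (ofʸ p)  _        = ofʸ λ (¬p , _) → ¬p p
¬¬-⊎-reflects (ofⁿ _)  (ofʸ q)  = ofʸ λ (_ , ¬q) → ¬q q
¬¬-⊎-reflects (ofⁿ ¬p) (ofⁿ ¬q) = ofⁿ λ ¬[¬p×¬q] → ¬[¬p×¬q] (¬p , ¬q)

_≟_ : DecidableEquality Fm
var m    ≟ var n    = map′ (cong var) (λ { refl → refl }) (m ℕ.≟ n)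
bot      ≟ bot      = yes refl
neg A    ≟ neg B    = map′ (cong neg) (λ { refl → refl }) (A ≟ B)
(A & B)  ≟ (C & D)  = map′ (uncurry (cong₂ _&_)) (λ { refl → refl , refl }) (A ≟ C ×-dec B ≟ D)
(A ∣∣ B) ≟ (C ∣∣ D) = map′ (uncurry (cong₂ _∣∣_)) (λ { refl → refl , refl }) (A ≟ C ×-dec B ≟ D)
(A ⇒ B)  ≟ (C ⇒ D)  = map′ (uncurry (cong₂ _⇒_)) (λ { refl → refl , refl }) (A ≟ C ×-dec B ≟ D)
box A    ≟ box B    = map′ (cong box) (λ { refl → refl }) (A ≟ B)
var _    ≟ bot      = no λ ()
var _    ≟ neg _    = no λ ()
var _    ≟ (_ & _)  = no λ ()
var _    ≟ (_ ∣∣ _) = no λ ()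
var _    ≟ (_ ⇒ _)  = no λ ()
var _    ≟ box _    = no λ ()
bot      ≟ var _    = no λ ()
bot      ≟ neg _    = no λ ()
bot      ≟ (_ & _)  = no λ ()
bot      ≟ (_ ∣∣ _) = no λ ()
bot      ≟ (_ ⇒ _)  = no λ ()
bot      ≟ box _    = no λ ()
neg _    ≟ var _    = no λ ()
neg _    ≟ bot      = no λ ()
neg _    ≟ (_ & _)  = no λ ()
neg _    ≟ (_ ∣∣ _) = no λ ()
neg _    ≟ (_ ⇒ _)  = no λ ()
neg _    ≟ box _    = no λ ()
(_ & _)  ≟ var _    = no λ ()
(_ & _)  ≟ bot      = no λ ()
(_ & _)  ≟ neg _    = no λ ()
(_ & _)  ≟ (_ ∣∣ _) = no λ ()
(_ & _)  ≟ (_ ⇒ _)  = no λ ()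
(_ & _)  ≟ box _    = no λ ()
(_ ∣∣ _) ≟ var _    = no λ ()
(_ ∣∣ _) ≟ bot      = no λ ()
(_ ∣∣ _) ≟ neg _    = no λ ()
(_ ∣∣ _) ≟ (_ & _)  = no λ ()
(_ ∣∣ _) ≟ (_ ⇒ _)  = no λ ()
(_ ∣∣ _) ≟ box _    = no λ ()
(_ ⇒ _)  ≟ var _    = no λ ()
(_ ⇒ _)  ≟ bot      = no λ ()
(_ ⇒ _)  ≟ neg _    = no λ ()
(_ ⇒ _)  ≟ (_ & _)  = no λ ()
(_ ⇒ _)  ≟ (_ ∣∣ _) = no λ ()
(_ ⇒ _)  ≟ box _    = no λ ()
box _    ≟ var _    = no λ ()
box _    ≟ bot      = no λ ()
box _    ≟ neg _    = no λ ()
box _    ≟ (_ & _)  = no λ ()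
box _    ≟ (_ ∣∣ _) = no λ ()
box _    ≟ (_ ⇒ _)  = no λ ()

atoms : Fm → List Fm
atoms (var n)  = [ var n ]
atoms bot      = []
atoms (neg A)  = atoms A
atoms (A & B)  = atoms A ++ atoms B
atoms (A ∣∣ B) = atoms A ++ atoms B
atoms (A ⇒ B)  = atoms A ++ atoms B
atoms (box B)  = [ box B ]

module _ (F : Frame) (V : Valuation F) where
  open Frame F using (W)

  ⊩-stable : ∀ A {x} → Stable ((F , V ⊩ x) A)
  ⊩-stable (var n)  = negated-stable
  ⊩-stable bot      ¬¬⊥ = ¬¬⊥ id
  ⊩-stable (neg A)  = negated-stable
  ⊩-stable (A & B)  ¬¬A&B = ⊩-stable A (¬¬-map proj₁ ¬¬A&B) , ⊩-stable B (¬¬-map proj₂ ¬¬A&B)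
  ⊩-stable (A ∣∣ B) = negated-stable
  ⊩-stable (A ⇒ B)  ¬¬A⇒B a = ⊩-stable B (¬¬-map (λ f → f a) ¬¬A⇒B)
  ⊩-stable (box B)  ¬¬□B y x≺y = ⊩-stable B (¬¬-map (λ f → f y x≺y) ¬¬□B)

  module _ (x : W) where

    evalB-reflects-⊩ : ∀ (g : Fm → Bool) A → All (λ a → Reflects ((F , V ⊩ x) a) (g a)) (atoms A) →
                       Reflects ((F , V ⊩ x) A) (evalB (g ∘ var) (g ∘ box) A)
    evalB-reflects-⊩ g (var n)  (r ∷ []) = r
    evalB-reflects-⊩ g bot      _        = ofⁿ id
    evalB-reflects-⊩ g (neg A)  rs       = ¬-reflects (evalB-reflects-⊩ g A rs)
    evalB-reflects-⊩ g (A & B)  rs       = let rsA , rsB = ++⁻ (atoms A) rs in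
      evalB-reflects-⊩ g A rsA ×-reflects evalB-reflects-⊩ g B rsB
    evalB-reflects-⊩ g (A ∣∣ B) rs       = let rsA , rsB = ++⁻ (atoms A) rs in
      ¬¬-⊎-reflects (evalB-reflects-⊩ g A rsA) (evalB-reflects-⊩ g B rsB)
    evalB-reflects-⊩ g (A ⇒ B)  rs       = let rsA , rsB = ++⁻ (atoms A) rs in
      evalB-reflects-⊩ g A rsA →-reflects evalB-reflects-⊩ g B rsB
    evalB-reflects-⊩ g (box B)  (r ∷ []) = r

    tautology-⊩ : ∀ {A} → Tautology A → (F , V ⊩ x) A
    tautology-⊩ {A} ⊨A = ⊩-stable A do
      g , rs ← ¬¬-reflecting-assignment _≟_ (F , V ⊩ x) (atoms A)
      pure (invert (subst (Reflects _) (⊨A (g ∘ var) (g ∘ box)) (evalB-reflects-⊩ g A rs)))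

corollary3p7 : ∀ (A : Fm) → NR⊢ A → (F : Frame) → Serial F → ValidIn F A
corollary3p7 A (taut ⊨A) F serial V x = tautology-⊩ F V x ⊨A
corollary3p7 B (mp ⊢A⇒B ⊢A) F serial V x =
  corollary3p7 _ ⊢A⇒B F serial V x (corollary3p7 _ ⊢A F serial V x)
corollary3p7 (box A) (nec ⊢A) F serial V x y _ = corollary3p7 A ⊢A F serial V y
corollary3p7 (neg (box B)) (rNR ⊢¬B) F serial V x □B =
  let y , x≺y = serial B x in corollary3p7 (neg B) ⊢¬B F serial V y (□B y x≺y)
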